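{- Let $n\geq 1$ and $k\geq 0$ be integers, let $E=(e_{1},\ldots,e_{k})\in \{1,\ldots,n\}^{k}$ and let $O=\{o_{1},\ldots,o_{k+1}\}\subset\{1,\ldots,n\}$ be a subset with $k+1$ elements. Let $\Pi(E,O)=(p_{1},\ldots,p_{k})$ be the result of the parking process and $\rho(E,O)$ its residue (defined below). Then: 1. The parking process is equivariant with respect to the shift modulo $n$, that is, $\Pi((1\ldots n)E,(1\ldots n)O)=(1\ldots n)\Pi(E,O)$ and $\rho((1\ldots n)E,(1\ldots n)O)=(1\ldots n)\rho(E,O)$, where $(1\ldots n)$ acts componentwise on sequences and elementwise on sets. 2. If $E'$ differs from $E$ by a permutation (of its entries), then $\Pi(E',O)$ differs from $\Pi(E,O)$ by a permutation. In particular, $\rho(E',O)=\rho(E,O)$. 3. If $\rho(E,O)=1$, then for all $l\in\{1,\ldots,k\}$, one has $e_{l}<p_{l}$.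
   Context: The parking process: given a sequence $E=(e_{1},\ldots,e_{k})\in\{1,\ldots,n\}^{k}$ of entry points and a set $O=\{o_{1},\ldots,o_{k+1}\}\subset\{1,\ldots,n\}$ of $k+1$ open spaces, define $(p_{1},\ldots,p_{k})$ by backwards induction: $p_{k}=(1\ldots n)^{r}e_{k}$ where $r=\min\{s\in\{1,\ldots,n\}:(1\ldots n)^{s}e_{k}\in O\}$, and, once $p_{k},\ldots,p_{l+1}$ are defined, $p_{l}=(1\ldots n)^{r}e_{l}$ where $r=\min\{s\in\{1,\ldots,n\}:(1\ldots n)^{s}e_{l}\in O\setminus\{p_{l+1},\ldots,p_{k}\}\}$. Here $(1\ldots n)$ is the $n$-cycle $i\mapsto i+1$ modulo $n$ on $\{1,\ldots,n\}$. Write $\Pi(E,O)=(p_{1},\ldots,p_{k})$. The set $O\setminus\{p_{1},\ldots,p_{k}\}$ has a single element, called the residue and denoted $\rho(E,O)$. The shift modulo $n$ is the action of $\mathbb{Z}/n\mathbb{Z}$ on $\{1,\ldots,n\}^{k}$ and on $(k+1)$-element subsets of $\{1,\ldots,n\}$ generated by $(1\ldots n)$ acting componentwise/elementwise. -}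

module Defs where

open import Data.Nat using (ℕ; zero; suc; _%_)
open import Data.Nat.DivMod using (m%n<n)
import Data.Vec
open import Data.Fin using (Fin; zero; suc; toℕ; fromℕ<; _≟_)
open import Data.Fin.Subset using (Subset; _-_; ⁅_⁆)
open import Data.Fin.Subset.Properties using (_∈?_)
open import Data.Fin.Properties using (any?)
open import Data.Vec using (Vec; []; _∷_; tabulate)
open import Data.Maybe using (Maybe; just; nothing; fromMaybe)
open import Data.Product using (_×_; _,_; proj₁; proj₂)
open import Relation.Nullary using (yes; no; ⌊_⌋)
open import Relation.Nullary.Decidable using (_×-dec_)
open import Relation.Binary.PropositionalEquality using (_≡_)

-- Convention: the places {1,…,n} with n = suc m are represented by Fin (suc m),
-- place i ∈ {1,…,n} being the element i-1 of Fin n (so place 1 is `zero`).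

shift : ∀ {m} → Fin (suc m) → Fin (suc m)
shift {m} i = fromℕ< (m%n<n (suc (toℕ i)) (suc m))

shiftSet : ∀ {m} → Subset (suc m) → Subset (suc m)
shiftSet {m} O = tabulate (λ y → ⌊ any? (λ x → (x ∈? O) ×-dec (shift x ≟ y)) ⌋)

shiftVec : ∀ {m k} → Vec (Fin (suc m)) k → Vec (Fin (suc m)) k
shiftVec = Data.Vec.map shift

firstFrom : ∀ {m} → ℕ → Fin (suc m) → Subset (suc m) → Maybe (Fin (suc m))
firstFrom zero    x S = nothing
firstFrom (suc f) x S with shift x ∈? S
... | yes _ = just (shift x)
... | no  _ = firstFrom f (shift x) S

-- (1…n)^r e with r = min {s ∈ {1,…,n} : (1…n)^s e ∈ S}.
-- (If S is empty this minimum does not exist; we then return e. This never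
-- happens in the parking process when O has k+1 elements.)
nextFree : ∀ {m} → Fin (suc m) → Subset (suc m) → Fin (suc m)
nextFree {m} e S = fromMaybe e (firstFrom (suc m) e S)

-- Backwards induction: parkAux (e_l ∷ … ∷ e_k) S returns
-- ((p_l, …, p_k), S ∖ {p_l, …, p_k}); p_{l} is computed after p_{l+1},…,p_k.
parkAux : ∀ {m k} → Vec (Fin (suc m)) k → Subset (suc m)
        → Vec (Fin (suc m)) k × Subset (suc m)
parkAux []       O = [] , O
parkAux (e ∷ es) O with parkAux es O
... | ps , S = nextFree e S ∷ ps , S - nextFree e S

Park : ∀ {m k} → Vec (Fin (suc m)) k → Subset (suc m) → Vec (Fin (suc m)) k
Park E O = proj₁ (parkAux E O)

Remaining : ∀ {m k} → Vec (Fin (suc m)) k → Subset (suc m) → Subset (suc m)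
Remaining E O = proj₂ (parkAux E O)

-- "ρ(E,O) = x": the residue O ∖ {p_1,…,p_k} is the single element x.
IsResidue : ∀ {m k} → Vec (Fin (suc m)) k → Subset (suc m) → Fin (suc m) → Set
IsResidue E O x = Remaining E O ≡ ⁅ x ⁆

module Submission where

-- We first
-- prove the needed facts about subsets and about the cyclic shift (it is
-- injective, shiftSet is its image, its iterates have period n and cover
-- every place), then the algebra of the search: it splits along f = g + h,
-- succeeds on nonempty sets, commutes with the shift, and after its answer
-- c is removed, a search from e behaves like a search restarted at c.
-- (1) Each step commutes with the shift, hence so does parking.
-- (2) Two consecutive steps commute as long as two places are free (two
--     cars aiming at the same place share the next one after it), and the
--     size invariant provides that room; so permutations of E are harmless.
-- (3) While place 1 is free no search wraps past it: cars park rightwards.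

open import Defs
open import Data.Nat using (ℕ; zero; suc; _<_; _≤_; _+_; _∸_; _%_; z≤n; s≤s)
import Data.Nat.Properties as ℕ
open import Data.Nat.DivMod using (m<n⇒m%n≡m; n%n≡0)
open import Data.Bool using (Bool; T)
open import Data.Bool.Properties using (T-≡)
open import Data.Fin using (Fin; zero; suc; toℕ; _≟_)
open import Data.Fin.Properties using (toℕ-fromℕ<; toℕ-injective; toℕ≤pred[n]; any?)
open import Data.Fin.Subset using (Subset; ∣_∣; _∈_; _∉_; _⊆_; _─_; _-_; ⁅_⁆; inside; outside; Nonempty)
open import Data.Fin.Subset.Properties
  using (_∈?_; x∈⁅x⁆; x∈⁅y⁆⇒x≡y; x∉⁅y⁆⇒x≢y; p─⊥≡p; p─q⊆p; x∈p∧x≢y⇒x∈p-y; p─x─y≡p─y─x; ⊆-antisym)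
open import Data.Vec using (Vec; []; _∷_; lookup; toList; tabulate; here; there)
open import Data.Vec.Properties using (lookup⇒[]=; []=⇒lookup; lookup∘tabulate; length-toList)
open import Data.List using (List; length; foldr) renaming ([] to []ᴸ; _∷_ to _∷ᴸ_)
open import Data.List.Relation.Binary.Permutation.Propositional using (_↭_)
import Data.List.Relation.Binary.Permutation.Propositional as Perm
open import Data.List.Relation.Binary.Permutation.Propositional.Properties using (↭-length)
open import Data.Maybe using (just; nothing; fromMaybe; _<∣>_)
import Data.Maybe as Maybe
open import Data.Maybe.Properties using (just-injective; <∣>-identityʳ)
open import Data.Product using (_×_; ∃; _,_; proj₁; proj₂; map₁)
open import Data.Sum using (_⊎_; inj₁; inj₂)
open import Function using (_∘_; Equivalence)
open import Relation.Nullary using (yes; no; ⌊_⌋; contradiction)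
open import Relation.Nullary.Decidable using (_×-dec_; toWitness; fromWitness)
open import Relation.Binary.PropositionalEquality
  using (_≡_; _≢_; refl; sym; trans; cong; cong₂; subst; subst₂; module ≡-Reasoning)

∈-tabulate⁺ : ∀ {n} (f : Fin n → Bool) {y} → T (f y) → y ∈ tabulate f
∈-tabulate⁺ f {y} t = lookup⇒[]= y (tabulate f) (trans (lookup∘tabulate f y) (Equivalence.to T-≡ t))

∈-tabulate⁻ : ∀ {n} (f : Fin n → Bool) {y} → y ∈ tabulate f → T (f y)
∈-tabulate⁻ f {y} y∈ = Equivalence.from T-≡ (trans (sym (lookup∘tabulate f y)) ([]=⇒lookup y∈))

x∈p─q⇒x∉q : ∀ {n} {x : Fin n} (p q : Subset n) → x ∈ p ─ q → x ∉ q
x∈p─q⇒x∉q (_ ∷ p) (outside ∷ q) here ()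
x∈p─q⇒x∉q (_ ∷ p) (_ ∷ q) (there x∈p─q) (there x∈q) = x∈p─q⇒x∉q p q x∈p─q x∈q

x∈p-y⇒x≢y : ∀ {n} {x y : Fin n} (p : Subset n) → x ∈ p - y → x ≢ y
x∈p-y⇒x≢y {y = y} p x∈ = x∉⁅y⁆⇒x≢y (x∈p─q⇒x∉q p ⁅ y ⁆ x∈)

p-x⊆p : ∀ {n} (p : Subset n) (x : Fin n) → p - x ⊆ p
p-x⊆p p x = p─q⊆p p ⁅ x ⁆

∣p-x∣+1≡∣p∣ : ∀ {n} {x : Fin n} {p : Subset n} → x ∈ p → suc ∣ p - x ∣ ≡ ∣ p ∣
∣p-x∣+1≡∣p∣ {p = inside ∷ p} here = cong (suc ∘ ∣_∣) (p─⊥≡p p)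
∣p-x∣+1≡∣p∣ {p = inside ∷ p} (there x∈p) = cong suc (∣p-x∣+1≡∣p∣ x∈p)
∣p-x∣+1≡∣p∣ {p = outside ∷ p} (there x∈p) = ∣p-x∣+1≡∣p∣ x∈p

∣p∣≥1⇒nonempty : ∀ {n} (p : Subset n) → 1 ≤ ∣ p ∣ → Nonempty p
∣p∣≥1⇒nonempty (inside ∷ p) _ = zero , here
∣p∣≥1⇒nonempty (outside ∷ p) 1≤∣p∣ = let (x , x∈p) = ∣p∣≥1⇒nonempty p 1≤∣p∣ in suc x , there x∈p

two⇒nonempty-after : ∀ {n} {p : Subset n} {x} → 2 ≤ ∣ p ∣ → x ∈ p → Nonempty (p - x)
two⇒nonempty-after {p = p} {x} 2≤∣p∣ x∈p =
  ∣p∣≥1⇒nonempty (p - x) (ℕ.≤-pred (subst (2 ≤_) (sym (∣p-x∣+1≡∣p∣ x∈p)) 2≤∣p∣))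

module _ {m : ℕ} where

  private
    Place : Set
    Place = Fin (suc m)
    Places : Set
    Places = Subset (suc m)

  shift-advance : (i : Place) → toℕ i < m → toℕ (shift i) ≡ suc (toℕ i)
  shift-advance i i<m = trans (toℕ-fromℕ< _) (m<n⇒m%n≡m (s≤s i<m))

  shift-wrap : (i : Place) → toℕ i ≡ m → shift i ≡ zero
  shift-wrap i i≡m = toℕ-injective (trans (toℕ-fromℕ< _) (trans (cong (λ t → suc t % suc m) i≡m) (n%n≡0 (suc m))))

  shift-cases : (i : Place) → toℕ i < m ⊎ toℕ i ≡ m
  shift-cases i = ℕ.m≤n⇒m<n∨m≡n (toℕ≤pred[n] i)

  shift-injective : (i j : Place) → shift i ≡ shift j → i ≡ j
  shift-injective i j eq with shift-cases i | shift-cases j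
  ... | inj₁ i<m | inj₁ j<m = toℕ-injective (ℕ.suc-injective
          (trans (sym (shift-advance i i<m)) (trans (cong toℕ eq) (shift-advance j j<m))))
  ... | inj₁ i<m | inj₂ j≡m with () ← trans (sym (shift-advance i i<m)) (cong toℕ (trans eq (shift-wrap j j≡m)))
  ... | inj₂ i≡m | inj₁ j<m with () ← trans (sym (shift-advance j j<m)) (cong toℕ (trans (sym eq) (shift-wrap i i≡m)))
  ... | inj₂ i≡m | inj₂ j≡m = toℕ-injective (trans i≡m (sym j≡m))

  private
    inImage : Places → Place → Bool
    inImage S y = ⌊ any? (λ x → (x ∈? S) ×-dec (shift x ≟ y)) ⌋

  ∈-shiftSet⁺ : ∀ {S : Places} {x} → x ∈ S → shift x ∈ shiftSet S
  ∈-shiftSet⁺ {S} {x} x∈S = ∈-tabulate⁺ (inImage S) (fromWitness (x , x∈S , refl))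

  ∈-shiftSet⁻ : ∀ {S : Places} {y} → y ∈ shiftSet S → ∃ λ x → x ∈ S × shift x ≡ y
  ∈-shiftSet⁻ {S} y∈ = toWitness (∈-tabulate⁻ (inImage S) y∈)

  shift∈shiftSet⁻ : ∀ {S : Places} {x} → shift x ∈ shiftSet S → x ∈ S
  shift∈shiftSet⁻ {S} {x} sx∈ with ∈-shiftSet⁻ sx∈
  ... | z , z∈S , sz≡sx = subst (_∈ S) (shift-injective z x sz≡sx) z∈S

  shiftSet-remove : ∀ (S : Places) c → shiftSet (S - c) ≡ shiftSet S - shift c
  shiftSet-remove S c = ⊆-antisym image⊆ ⊆image
    where
    image⊆ : shiftSet (S - c) ⊆ shiftSet S - shift c
    image⊆ y∈ with ∈-shiftSet⁻ y∈
    ... | x , x∈S-c , refl = x∈p∧x≢y⇒x∈p-y (∈-shiftSet⁺ (p-x⊆p S c x∈S-c))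
                               (x∈p-y⇒x≢y S x∈S-c ∘ shift-injective x c)
    ⊆image : shiftSet S - shift c ⊆ shiftSet (S - c)
    ⊆image y∈ with ∈-shiftSet⁻ (p-x⊆p (shiftSet S) (shift c) y∈)
    ... | x , x∈S , refl = ∈-shiftSet⁺ (x∈p∧x≢y⇒x∈p-y x∈S (x∈p-y⇒x≢y (shiftSet S) y∈ ∘ cong shift))

  shiftSet-⁅⁆ : ∀ (c : Place) → shiftSet ⁅ c ⁆ ≡ ⁅ shift c ⁆
  shiftSet-⁅⁆ c = ⊆-antisym image⊆ ⊆image
    where
    image⊆ : shiftSet ⁅ c ⁆ ⊆ ⁅ shift c ⁆
    image⊆ y∈ with ∈-shiftSet⁻ y∈
    ... | x , x∈⁅c⁆ , refl = subst (λ z → shift z ∈ ⁅ shift c ⁆) (sym (x∈⁅y⁆⇒x≡y c x∈⁅c⁆)) (x∈⁅x⁆ (shift c))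
    ⊆image : ⁅ shift c ⁆ ⊆ shiftSet ⁅ c ⁆
    ⊆image y∈ = subst (_∈ shiftSet ⁅ c ⁆) (sym (x∈⁅y⁆⇒x≡y (shift c) y∈)) (∈-shiftSet⁺ (x∈⁅x⁆ c))

  -- iter j x = shiftʲ x, unfolding on the right as firstFrom does.
  iter : ℕ → Place → Place
  iter zero x = x
  iter (suc j) x = iter j (shift x)

  iter-+ : ∀ a b x → iter (a + b) x ≡ iter b (iter a x)
  iter-+ zero b x = refl
  iter-+ (suc a) b x = iter-+ a b (shift x)

  iter-suc : ∀ j x → iter (suc j) x ≡ shift (iter j x)
  iter-suc j x = trans (cong (λ t → iter t x) (ℕ.+-comm 1 j)) (iter-+ j 1 x)

  iter-toℕ : ∀ j x → toℕ x + j ≤ m → toℕ (iter j x) ≡ toℕ x + j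
  iter-toℕ zero x _ = sym (ℕ.+-identityʳ (toℕ x))
  iter-toℕ (suc j) x x+1+j≤m = begin
      toℕ (iter j (shift x)) ≡⟨ iter-toℕ j (shift x) (subst (_≤ m) x+1+j≡sx+j x+1+j≤m) ⟩
      toℕ (shift x) + j      ≡⟨ sym x+1+j≡sx+j ⟩
      toℕ x + suc j          ∎
    where
    open ≡-Reasoning
    x<m : toℕ x < m
    x<m = ℕ.≤-trans (s≤s (ℕ.m≤m+n (toℕ x) j)) (subst (_≤ m) (ℕ.+-suc (toℕ x) j) x+1+j≤m)
    x+1+j≡sx+j : toℕ x + suc j ≡ toℕ (shift x) + j
    x+1+j≡sx+j = trans (ℕ.+-suc (toℕ x) j) (cong (_+ j) (sym (shift-advance x x<m)))

  iter-wrap : ∀ x → iter (suc (m ∸ toℕ x)) x ≡ zero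
  iter-wrap x = trans (iter-suc (m ∸ toℕ x) x) (shift-wrap _ (trans (iter-toℕ _ x (ℕ.≤-reflexive x+d≡m)) x+d≡m))
    where
    x+d≡m : toℕ x + (m ∸ toℕ x) ≡ m
    x+d≡m = ℕ.m+[n∸m]≡n (toℕ≤pred[n] x)

  iter-from-zero : ∀ y → iter (toℕ y) zero ≡ y
  iter-from-zero y = toℕ-injective (iter-toℕ (toℕ y) zero (toℕ≤pred[n] y))

  iter-via-zero : ∀ x y → iter (suc (m ∸ toℕ x) + toℕ y) x ≡ y
  iter-via-zero x y = begin
      iter (suc (m ∸ toℕ x) + toℕ y) x        ≡⟨ iter-+ (suc (m ∸ toℕ x)) (toℕ y) x ⟩
      iter (toℕ y) (iter (suc (m ∸ toℕ x)) x) ≡⟨ cong (iter (toℕ y)) (iter-wrap x) ⟩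
      iter (toℕ y) zero                       ≡⟨ iter-from-zero y ⟩
      y                                       ∎
    where open ≡-Reasoning

  iter-period : ∀ x → iter (suc m) x ≡ x
  iter-period x = trans (cong (λ t → iter (suc t) x) (sym (ℕ.m∸n+n≡m (toℕ≤pred[n] x)))) (iter-via-zero x x)

  iter-covers : ∀ x y → ∃ λ j → j < suc m × iter (suc j) x ≡ y
  iter-covers x y with ℕ.≤-<-connex (toℕ y) (toℕ x)
  ... | inj₁ y≤x = (m ∸ toℕ x) + toℕ y
                 , s≤s (subst ((m ∸ toℕ x) + toℕ y ≤_) (ℕ.m∸n+n≡m (toℕ≤pred[n] x)) (ℕ.+-monoʳ-≤ (m ∸ toℕ x) y≤x))
                 , iter-via-zero x y
  ... | inj₂ x<y with ℕ.m≤n⇒∃[o]m+o≡n x<y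
  ... | o , x+1+o≡y = o
                    , s≤s (ℕ.≤-trans (ℕ.m≤n+m o (suc (toℕ x))) (subst (_≤ m) (sym x+1+o≡y) (toℕ≤pred[n] y)))
                    , toℕ-injective (trans (iter-toℕ (suc o) x (subst (_≤ m) (sym x+o≡y) (toℕ≤pred[n] y))) x+o≡y)
    where
    x+o≡y : toℕ x + suc o ≡ toℕ y
    x+o≡y = trans (ℕ.+-suc (toℕ x) o) x+1+o≡y

  firstFrom-miss-step : ∀ {f x} {S : Places} → shift x ∉ S → firstFrom (suc f) x S ≡ firstFrom f (shift x) S
  firstFrom-miss-step {x = x} {S} sx∉S with shift x ∈? S
  ... | yes sx∈S = contradiction sx∈S sx∉S
  ... | no _ = refl

  firstFrom-+ : ∀ g h x (S : Places) → firstFrom (g + h) x S ≡ (firstFrom g x S <∣> firstFrom h (iter g x) S)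
  firstFrom-+ zero h x S = refl
  firstFrom-+ (suc g) h x S with shift x ∈? S
  ... | yes _ = refl
  ... | no _ = firstFrom-+ g h (shift x) S

  firstFrom-hit : ∀ f x (S : Places) {c} → firstFrom f x S ≡ just c →
    ∃ λ d → d < f × iter (suc d) x ≡ c × firstFrom d x S ≡ nothing × c ∈ S
  firstFrom-hit (suc f) x S found with shift x ∈? S
  ... | yes sx∈S = 0 , s≤s z≤n , just-injective found , refl , subst (_∈ S) (just-injective found) sx∈S
  ... | no sx∉S with firstFrom-hit f (shift x) S found
  ... | d , d<f , reached , missed , c∈S = suc d , s≤s d<f , reached , trans (firstFrom-miss-step sx∉S) missed , c∈S

  firstFrom-∈ : ∀ {f x} {S : Places} {c} → firstFrom f x S ≡ just c → c ∈ S
  firstFrom-∈ {f} {x} {S} found = proj₂ (proj₂ (proj₂ (proj₂ (firstFrom-hit f x S found))))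

  firstFrom-miss : ∀ f x (S : Places) → firstFrom f x S ≡ nothing → ∀ j → j < f → iter (suc j) x ∉ S
  firstFrom-miss (suc f) x S missed j j<f with shift x ∈? S
  firstFrom-miss (suc f) x S () j j<f | yes _
  firstFrom-miss (suc f) x S missed zero j<f | no sx∉S = sx∉S
  firstFrom-miss (suc f) x S missed (suc j) (s≤s j<f) | no _ = firstFrom-miss f (shift x) S missed j j<f

  firstFrom-miss-⊆ : ∀ {T S : Places} → T ⊆ S → ∀ f x → firstFrom f x S ≡ nothing → firstFrom f x T ≡ nothing
  firstFrom-miss-⊆ T⊆S zero x missed = refl
  firstFrom-miss-⊆ {T} {S} T⊆S (suc f) x missed with shift x ∈? T | shift x ∈? S
  ... | _ | yes _ with () ← missed
  ... | yes sx∈T | no sx∉S = contradiction (T⊆S sx∈T) sx∉S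
  ... | no _ | no _ = firstFrom-miss-⊆ T⊆S f (shift x) missed

  firstFrom-miss-extend : ∀ d x (S : Places) → firstFrom d x S ≡ nothing → iter (suc d) x ∉ S →
    firstFrom (suc d) x S ≡ nothing
  firstFrom-miss-extend d x S missed next∉S = begin
      firstFrom (suc d) x S                          ≡⟨ cong (λ f → firstFrom f x S) (ℕ.+-comm 1 d) ⟩
      firstFrom (d + 1) x S                          ≡⟨ firstFrom-+ d 1 x S ⟩
      firstFrom d x S <∣> firstFrom 1 (iter d x) S   ≡⟨ cong₂ _<∣>_ missed (firstFrom-miss-step (subst (_∉ S) (iter-suc d x) next∉S)) ⟩
      nothing                                        ∎
    where open ≡-Reasoning

  firstFrom-remove : ∀ f x (S : Places) {c y} → firstFrom f x S ≡ just y → c ≢ y → firstFrom f x (S - c) ≡ just y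
  firstFrom-remove (suc f) x S {c} found c≢y with shift x ∈? S | shift x ∈? (S - c)
  ... | yes _ | yes _ = found
  ... | yes sx∈S | no sx∉S-c = contradiction (x∈p∧x≢y⇒x∈p-y sx∈S (λ sx≡c → c≢y (trans (sym sx≡c) (just-injective found)))) sx∉S-c
  ... | no sx∉S | yes sx∈S-c = contradiction (p-x⊆p S c sx∈S-c) sx∉S
  ... | no _ | no _ = firstFrom-remove f (shift x) S found c≢y

  firstFrom-total : ∀ x (S : Places) → Nonempty S → ∃ λ c → firstFrom (suc m) x S ≡ just c
  firstFrom-total x S (y , y∈S) with firstFrom (suc m) x S in result
  ... | just c = c , refl
  ... | nothing with iter-covers x y
  ... | j , j<n , reached = contradiction (subst (_∈ S) (sym reached) y∈S) (firstFrom-miss (suc m) x S result j j<n)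

  -- If a full search from x finds c, then in S - c a full search from x
  -- gives the same answer as a full search restarted at c: the steps up to
  -- and including c now miss, and after c both scan the same places.
  firstFrom-restart : ∀ x (S : Places) {c} → firstFrom (suc m) x S ≡ just c →
    firstFrom (suc m) x (S - c) ≡ firstFrom (suc m) c (S - c)
  firstFrom-restart x S {c} found with firstFrom-hit (suc m) x S found
  ... | d , d<n , reached , missed , _ with ℕ.m≤n⇒∃[o]m+o≡n d<n
  ... | r , 1+d+r≡n = trans from-x (sym from-c)
    where
    open ≡-Reasoning
    S∖c : Places
    S∖c = S - c
    missed-to-c : firstFrom (suc d) x S∖c ≡ nothing
    missed-to-c = firstFrom-miss-extend d x S∖c (firstFrom-miss-⊆ (p-x⊆p S c) d x missed)
                    (subst (_∉ S∖c) (sym reached) (λ c∈S∖c → x∈p-y⇒x≢y S c∈S∖c refl))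
    from-x : firstFrom (suc m) x S∖c ≡ firstFrom r c S∖c
    from-x = begin
      firstFrom (suc m) x S∖c                                      ≡⟨ cong (λ f → firstFrom f x S∖c) (sym 1+d+r≡n) ⟩
      firstFrom (suc d + r) x S∖c                                  ≡⟨ firstFrom-+ (suc d) r x S∖c ⟩
      firstFrom (suc d) x S∖c <∣> firstFrom r (iter (suc d) x) S∖c ≡⟨ cong₂ (λ u z → u <∣> firstFrom r z S∖c) missed-to-c reached ⟩
      firstFrom r c S∖c                                            ∎
    around : iter r c ≡ x
    around = begin
      iter r c                 ≡⟨ cong (iter r) (sym reached) ⟩
      iter r (iter (suc d) x)  ≡⟨ sym (iter-+ (suc d) r x) ⟩
      iter (suc d + r) x       ≡⟨ cong (λ t → iter t x) 1+d+r≡n ⟩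
      iter (suc m) x           ≡⟨ iter-period x ⟩
      x                        ∎
    from-c : firstFrom (suc m) c S∖c ≡ firstFrom r c S∖c
    from-c = begin
      firstFrom (suc m) c S∖c                                ≡⟨ cong (λ f → firstFrom f c S∖c) (trans (sym 1+d+r≡n) (ℕ.+-comm (suc d) r)) ⟩
      firstFrom (r + suc d) c S∖c                            ≡⟨ firstFrom-+ r (suc d) c S∖c ⟩
      firstFrom r c S∖c <∣> firstFrom (suc d) (iter r c) S∖c ≡⟨ cong (λ z → firstFrom r c S∖c <∣> firstFrom (suc d) z S∖c) around ⟩
      firstFrom r c S∖c <∣> firstFrom (suc d) x S∖c          ≡⟨ cong (firstFrom r c S∖c <∣>_) missed-to-c ⟩
      firstFrom r c S∖c <∣> nothing                          ≡⟨ <∣>-identityʳ _ ⟩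
      firstFrom r c S∖c                                      ∎

  firstFrom-shift : ∀ f x (S : Places) → firstFrom f (shift x) (shiftSet S) ≡ Maybe.map shift (firstFrom f x S)
  firstFrom-shift zero x S = refl
  firstFrom-shift (suc f) x S with shift x ∈? S | shift (shift x) ∈? shiftSet S
  ... | yes _ | yes _ = refl
  ... | yes sx∈S | no ssx∉ = contradiction (∈-shiftSet⁺ sx∈S) ssx∉
  ... | no sx∉S | yes ssx∈ = contradiction (shift∈shiftSet⁻ ssx∈) sx∉S
  ... | no _ | no _ = firstFrom-shift f (shift x) S

  firstFrom-before-wrap : ∀ {S : Places} → zero ∈ S → ∀ f x → suc m ≤ f + toℕ x →
    ∃ λ y → firstFrom f x S ≡ just y × (y ≡ zero ⊎ toℕ x < toℕ y)
  firstFrom-before-wrap zero∈S zero x n≤x = contradiction (ℕ.≤-trans n≤x (toℕ≤pred[n] x)) (ℕ.<-irrefl refl)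
  firstFrom-before-wrap {S} zero∈S (suc f) x n≤f+x with shift x ∈? S | shift-cases x
  ... | yes _ | inj₁ x<m = shift x , refl , inj₂ (ℕ.≤-reflexive (sym (shift-advance x x<m)))
  ... | yes _ | inj₂ x≡m = shift x , refl , inj₁ (shift-wrap x x≡m)
  ... | no sx∉S | inj₂ x≡m = contradiction (subst (_∈ S) (sym (shift-wrap x x≡m)) zero∈S) sx∉S
  ... | no _ | inj₁ x<m with firstFrom-before-wrap zero∈S f (shift x)
                               (subst (suc m ≤_) (trans (sym (ℕ.+-suc f (toℕ x))) (cong (f +_) (sym (shift-advance x x<m)))) n≤f+x)
  ... | y , found , inj₁ y≡0 = y , found , inj₁ y≡0
  ... | y , found , inj₂ sx<y = y , found , inj₂ (ℕ.<-trans (ℕ.≤-reflexive (sym (shift-advance x x<m))) sx<y)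

  nextFree-of : ∀ {e} {S : Places} {c} → firstFrom (suc m) e S ≡ just c → nextFree e S ≡ c
  nextFree-of {e} found = cong (fromMaybe e) found

  nextFree-found : ∀ e (S : Places) → Nonempty S → firstFrom (suc m) e S ≡ just (nextFree e S)
  nextFree-found e S nonempty with firstFrom-total e S nonempty
  ... | c , found = trans found (cong just (sym (nextFree-of found)))

  nextFree-∈ : ∀ e (S : Places) → Nonempty S → nextFree e S ∈ S
  nextFree-∈ e S nonempty = firstFrom-∈ (nextFree-found e S nonempty)

  nextFree-shift : ∀ e (S : Places) → nextFree (shift e) (shiftSet S) ≡ shift (nextFree e S)
  nextFree-shift e S with firstFrom (suc m) e S | firstFrom-shift (suc m) e S
  ... | just c | found = nextFree-of found
  ... | nothing | missed = cong (fromMaybe (shift e)) missed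

  nextFree-restart : ∀ x (S : Places) {c} → firstFrom (suc m) x S ≡ just c → Nonempty (S - c) →
    nextFree x (S - c) ≡ nextFree c (S - c)
  nextFree-restart x S {c} found nonempty = begin
      fromMaybe x (firstFrom (suc m) x (S - c))  ≡⟨ cong (fromMaybe x) (firstFrom-restart x S found) ⟩
      fromMaybe x (firstFrom (suc m) c (S - c))  ≡⟨ cong (fromMaybe x) (nextFree-found c (S - c) nonempty) ⟩
      nextFree c (S - c)                         ∎
    where open ≡-Reasoning

  nextFree-right : ∀ e (S : Places) → zero ∈ S - nextFree e S → toℕ e < toℕ (nextFree e S)
  nextFree-right e S zero∈rest with firstFrom-before-wrap (p-x⊆p S _ zero∈rest) (suc m) e (ℕ.m≤m+n (suc m) (toℕ e))
  ... | y , found , inj₁ y≡0 = contradiction (trans (nextFree-of found) y≡0) (x∈p-y⇒x≢y S zero∈rest ∘ sym)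
  ... | y , found , inj₂ e<y = subst (λ p → toℕ e < toℕ p) (sym (nextFree-of found)) e<y

  parkStep : ∀ {k} → Place → Vec Place k × Places → Vec Place (suc k) × Places
  parkStep e (ps , S) = nextFree e S ∷ ps , S - nextFree e S

  parkAux-∷ : ∀ {k} e (es : Vec Place k) (O : Places) → parkAux (e ∷ es) O ≡ parkStep e (parkAux es O)
  parkAux-∷ e es O with parkAux es O
  ... | _ , _ = refl

  shiftState : ∀ {k} → Vec Place k × Places → Vec Place k × Places
  shiftState (ps , S) = shiftVec ps , shiftSet S

  parkStep-shift : ∀ {k} e (st : Vec Place k × Places) → parkStep (shift e) (shiftState st) ≡ shiftState (parkStep e st)
  parkStep-shift e (ps , S) =
    cong₂ _,_ (cong (_∷ shiftVec ps) (nextFree-shift e S))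
              (trans (cong (shiftSet S -_) (nextFree-shift e S)) (sym (shiftSet-remove S (nextFree e S))))

  parkAux-shift : ∀ {k} (E : Vec Place k) (O : Places) → parkAux (shiftVec E) (shiftSet O) ≡ shiftState (parkAux E O)
  parkAux-shift [] O = refl
  parkAux-shift (e ∷ es) O = begin
      parkAux (shift e ∷ shiftVec es) (shiftSet O)            ≡⟨ parkAux-∷ (shift e) (shiftVec es) (shiftSet O) ⟩
      parkStep (shift e) (parkAux (shiftVec es) (shiftSet O)) ≡⟨ cong (parkStep (shift e)) (parkAux-shift es O) ⟩
      parkStep (shift e) (shiftState (parkAux es O))          ≡⟨ parkStep-shift e (parkAux es O) ⟩
      shiftState (parkStep e (parkAux es O))                  ≡⟨ cong shiftState (sym (parkAux-∷ e es O)) ⟩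
      shiftState (parkAux (e ∷ es) O)                         ∎
    where open ≡-Reasoning

  -- Part 2: permuting the entries.  Permutations are lists, so parking is
  -- replayed on lists, and the result is compared up to the relation _≈_:
  -- same spots up to order, same remaining set.
  parkStepᴸ : Place → List Place × Places → List Place × Places
  parkStepᴸ e (ps , S) = nextFree e S ∷ᴸ ps , S - nextFree e S

  parkList : List Place → Places → List Place × Places
  parkList es O = foldr parkStepᴸ ([]ᴸ , O) es

  parkAux-toList : ∀ {k} (E : Vec Place k) (O : Places) → map₁ toList (parkAux E O) ≡ parkList (toList E) O
  parkAux-toList [] O = refl
  parkAux-toList (e ∷ es) O = trans (cong (map₁ toList) (parkAux-∷ e es O)) (cong (parkStepᴸ e) (parkAux-toList es O))

  infix 4 _≈_
  _≈_ : List Place × Places → List Place × Places → Set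
  (ps , S) ≈ (ps′ , S′) = ps ↭ ps′ × S ≡ S′

  ≈-trans : ∀ {s t u} → s ≈ t → t ≈ u → s ≈ u
  ≈-trans (p , refl) (q , refl) = Perm.↭-trans p q , refl

  parkStepᴸ-cong : ∀ e {st st′} → st ≈ st′ → parkStepᴸ e st ≈ parkStepᴸ e st′
  parkStepᴸ-cong e (ps↭ps′ , refl) = Perm.prep _ ps↭ps′ , refl

  -- If cx ≢ cy they do not interact; if cx ≡ cy the second
  -- car takes the next free place after cx, whoever it is.
  twoCars : ∀ {x y} {S : Places} {cx cy ps ps′} → 2 ≤ ∣ S ∣ →
    firstFrom (suc m) x S ≡ just cx → firstFrom (suc m) y S ≡ just cy → ps ↭ ps′ →
    parkStepᴸ x (cy ∷ᴸ ps , S - cy) ≈ parkStepᴸ y (cx ∷ᴸ ps′ , S - cx)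
  twoCars {x} {y} {S} {cx} {cy} 2≤∣S∣ found-x found-y ps↭ps′ with cx ≟ cy
  ... | yes refl rewrite nextFree-restart x S found-x (two⇒nonempty-after 2≤∣S∣ (firstFrom-∈ found-x))
                       | nextFree-restart y S found-y (two⇒nonempty-after 2≤∣S∣ (firstFrom-∈ found-x))
    = Perm.prep _ (Perm.prep _ ps↭ps′) , refl
  ... | no cx≢cy rewrite nextFree-of (firstFrom-remove (suc m) x S found-x (cx≢cy ∘ sym))
                       | nextFree-of (firstFrom-remove (suc m) y S found-y cx≢cy)
    = Perm.swap cx cy ps↭ps′ , p─x─y≡p─y─x S cy cx

  parkStepᴸ-commute : ∀ x y {st st′} → 2 ≤ ∣ proj₂ st ∣ → st ≈ st′ →
    parkStepᴸ x (parkStepᴸ y st) ≈ parkStepᴸ y (parkStepᴸ x st′)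
  parkStepᴸ-commute x y {_ , S} 2≤∣S∣ (ps↭ps′ , refl) =
    twoCars 2≤∣S∣ (nextFree-found x S nonempty) (nextFree-found y S nonempty) ps↭ps′
    where
    nonempty : Nonempty S
    nonempty = ∣p∣≥1⇒nonempty S (ℕ.≤-trans (ℕ.n≤1+n 1) 2≤∣S∣)

  -- Size invariant: while there are at most |O| cars, every car finds a
  -- place, so each one removes exactly one place from the free set.
  parkList-size : ∀ es (O : Places) → length es ≤ ∣ O ∣ → ∣ proj₂ (parkList es O) ∣ + length es ≡ ∣ O ∣
  parkList-size []ᴸ O _ = ℕ.+-identityʳ ∣ O ∣
  parkList-size (e ∷ᴸ es) O 1+es≤∣O∣ = begin
      ∣ S - nextFree e S ∣ + suc (length es)  ≡⟨ ℕ.+-suc _ (length es) ⟩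
      suc ∣ S - nextFree e S ∣ + length es    ≡⟨ cong (_+ length es) (∣p-x∣+1≡∣p∣ (nextFree-∈ e S nonempty)) ⟩
      ∣ S ∣ + length es                       ≡⟨ size ⟩
      ∣ O ∣                                   ∎
    where
    open ≡-Reasoning
    S : Places
    S = proj₂ (parkList es O)
    size : ∣ S ∣ + length es ≡ ∣ O ∣
    size = parkList-size es O (ℕ.≤-trans (ℕ.n≤1+n _) 1+es≤∣O∣)
    nonempty : Nonempty S
    nonempty = ∣p∣≥1⇒nonempty S (ℕ.+-cancelʳ-≤ (length es) 1 ∣ S ∣ (subst (suc (length es) ≤_) (sym size) 1+es≤∣O∣))

  parkList-↭ : ∀ {xs ys} → xs ↭ ys → ∀ (O : Places) → length xs ≤ ∣ O ∣ → parkList xs O ≈ parkList ys O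
  parkList-↭ Perm.refl O _ = Perm.↭-refl , refl
  parkList-↭ (Perm.prep x xs↭ys) O 1+xs≤∣O∣ = parkStepᴸ-cong x (parkList-↭ xs↭ys O (ℕ.≤-trans (ℕ.n≤1+n _) 1+xs≤∣O∣))
  parkList-↭ (Perm.swap {xs} x y xs↭ys) O 2+xs≤∣O∣ =
    parkStepᴸ-commute x y 2≤∣S∣ (parkList-↭ xs↭ys O xs≤∣O∣)
    where
    xs≤∣O∣ : length xs ≤ ∣ O ∣
    xs≤∣O∣ = ℕ.≤-trans (ℕ.m≤n+m _ 2) 2+xs≤∣O∣
    S : Places
    S = proj₂ (parkList xs O)
    2≤∣S∣ : 2 ≤ ∣ S ∣
    2≤∣S∣ = ℕ.+-cancelʳ-≤ (length xs) 2 ∣ S ∣ (subst (2 + length xs ≤_) (sym (parkList-size xs O xs≤∣O∣)) 2+xs≤∣O∣)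
  parkList-↭ (Perm.trans xs↭ys ys↭zs) O xs≤∣O∣ =
    ≈-trans (parkList-↭ xs↭ys O xs≤∣O∣) (parkList-↭ ys↭zs O (subst (_≤ ∣ O ∣) (↭-length xs↭ys) xs≤∣O∣))

  park-↭ : ∀ {k} (E E′ : Vec Place k) (O : Places) → toList E′ ↭ toList E → k ≤ ∣ O ∣ →
    (toList (Park E′ O) ↭ toList (Park E O)) × Remaining E′ O ≡ Remaining E O
  park-↭ E E′ O E′↭E k≤∣O∣ =
    subst₂ _≈_ (sym (parkAux-toList E′ O)) (sym (parkAux-toList E O))
      (parkList-↭ E′↭E O (subst (_≤ ∣ O ∣) (sym (length-toList E′)) k≤∣O∣))

  park-right : ∀ {k} (E : Vec Place k) (O : Places) → zero ∈ Remaining E O →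
    ∀ l → toℕ (lookup E l) < toℕ (lookup (Park E O) l)
  park-right (e ∷ es) O zero∈rest rewrite parkAux-∷ e es O = λ where
    zero → nextFree-right e (Remaining es O) zero∈rest
    (suc l) → park-right es O (p-x⊆p (Remaining es O) _ zero∈rest) l

lemma5p1 : ∀ (m k : ℕ) (E : Vec (Fin (suc m)) k) (O : Subset (suc m))
    → ∣ O ∣ ≡ suc k
    → ((Park (shiftVec E) (shiftSet O) ≡ shiftVec (Park E O))
    × (∀ x → IsResidue E O x → IsResidue (shiftVec E) (shiftSet O) (shift x)))
    × (∀ (E′ : Vec (Fin (suc m)) k) → toList E′ ↭ toList E
    → (toList (Park E′ O) ↭ toList (Park E O))
    × (∀ x → IsResidue E O x → IsResidue E′ O x))
    × (IsResidue E O zero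
    → ∀ (l : Fin k) → toℕ (lookup E l) < toℕ (lookup (Park E O) l))
lemma5p1 m k E O ∣O∣≡1+k =
  ( cong proj₁ (parkAux-shift E O)
  , λ x residue → trans (cong proj₂ (parkAux-shift E O)) (trans (cong shiftSet residue) (shiftSet-⁅⁆ x)) )
  , (λ E′ E′↭E → let (places↭ , same-rest) = park-↭ E E′ O E′↭E k≤∣O∣
                 in places↭ , λ x residue → trans same-rest residue)
  , (λ residue → park-right E O (subst (zero ∈_) (sym residue) (x∈⁅x⁆ zero)))
  where
  k≤∣O∣ : k ≤ ∣ O ∣
  k≤∣O∣ = subst (k ≤_) (sym ∣O∣≡1+k) (ℕ.n≤1+n k)
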